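{- Let $\Lambda$ be an applied $\lambda$-calculus, let $\mathcal M$ and $\mathcal N$ be type frames that are models of $\Lambda$, and let $\mathrm E$ be a pre-logical surjection from $\mathcal M$ to $\mathcal N$ such that for every constant $c{:}\sigma$ of $\Lambda$, $([\![c]\!]^{\mathcal M},[\![c]\!]^{\mathcal N})\in\mathrm E_\sigma$. Then $\mathrm{Th}^\Lambda(\mathcal M)\subseteq\mathrm{Th}^\Lambda(\mathcal N)$, i.e. for all closed $\Lambda$-terms $P,Q$ of the same type, $[\![P]\!]^{\mathcal M}=[\![Q]\!]^{\mathcal M}$ implies $[\![P]\!]^{\mathcal N}=[\![Q]\!]^{\mathcal N}$.
   Context: An applied $\lambda$-calculus over a set $K$ of ground types is a simply typed $\lambda$-calculus with a family of typed constants, $\beta$-reduction and $\delta$-rules for constants. A type frame $\mathcal M$ over $K$ is a family of sets $\mathcal M_\sigma$ indexed by simple types with $\mathcal M_{\sigma\to\tau}$ a set of functions $\mathcal M_\sigma\to\mathcal M_\tau$; it is a model of $\Lambda$ when, for a given interpretation of constants, the environment-based interpretation ($[\![x]\!]_\rho=\rho(x)$, constants by their interpretation, application as function application, $[\![\lambda x.P]\!]_\rho=(d\mapsto[\![P]\!]_{\rho[x:=d]})$) is well defined in the frame and validates the $\delta$-rules. A binary pre-logical relation between $\mathcal M,\mathcal N$ is a family $\mathrm R_\sigma\subseteq\mathcal M_\sigma\times\mathcal N_\sigma$ such that (1) $(f,g)\in\mathrm R_{\sigma\to\tau}$, $(x,y)\in\mathrm R_\sigma$ imply $(f(x),g(y))\in\mathrm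 R_\tau$; (2) for every term $P{:}\tau$ of the pure simply typed $\lambda$-calculus (no constants), variable $z{:}\sigma$, and environments $\rho,\rho'$ pointwise related by $\mathrm R$: if $([\![P]\!]^{\mathcal M}_{\rho[z:=a]},[\![P]\!]^{\mathcal N}_{\rho'[z:=b]})\in\mathrm R_\tau$ for all $(a,b)\in\mathrm R_\sigma$, then $([\![\lambda z.P]\!]^{\mathcal M}_\rho,[\![\lambda z.P]\!]^{\mathcal N}_{\rho'})\in\mathrm R_{\sigma\to\tau}$. A pre-logical surjection is a pre-logical relation which at every type is surjective onto $\mathcal N_\sigma$ and a partial function. $\mathrm{Th}^\Lambda(\mathcal M)$ is the set of equations $P=Q$ between closed $\Lambda$-terms with $[\![P]\!]^{\mathcal M}=[\![Q]\!]^{\mathcal M}$. -}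

module Defs where

open import Data.Empty using (⊥; ⊥-elim)
open import Data.Product using (Σ; ∃; _×_; _,_)
open import Data.List using (List; []; _∷_)
open import Relation.Binary.PropositionalEquality using (_≡_)

data Ty (K : Set) : Set where
  ι   : K → Ty K
  _⇒_ : Ty K → Ty K → Ty K

infixr 7 _⇒_

Ctx : Set → Set
Ctx K = List (Ty K)

data _∋_ {K : Set} : Ctx K → Ty K → Set where
  here  : ∀ {Γ σ} → (σ ∷ Γ) ∋ σ
  there : ∀ {Γ σ τ} → Γ ∋ σ → (τ ∷ Γ) ∋ σ

data Term {K : Set} (C : Ty K → Set) (Γ : Ctx K) : Ty K → Set where
  var : ∀ {σ} → Γ ∋ σ → Term C Γ σ
  con : ∀ {σ} → C σ → Term C Γ σ
  app : ∀ {σ τ} → Term C Γ (σ ⇒ τ) → Term C Γ σ → Term C Γ τ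
  lam : ∀ {σ τ} → Term C (σ ∷ Γ) τ → Term C Γ (σ ⇒ τ)

NoConst : {K : Set} → Ty K → Set
NoConst _ = ⊥

PureTerm : {K : Set} → Ctx K → Ty K → Set
PureTerm = Term NoConst

-- An applied λ-calculus: typed constants plus δ-rules (pairs of terms of
-- the same type); β-reduction is built in.
record Applied (K : Set) : Set₁ where
  field
    Const : Ty K → Set
    Delta : ∀ {Γ σ} → Term Const Γ σ → Term Const Γ σ → Set

embed : {K : Set} {C : Ty K → Set} {Γ : Ctx K} {σ : Ty K} →
        PureTerm Γ σ → Term C Γ σ
embed (var v)   = var v
embed (con ())
embed (app P Q) = app (embed P) (embed Q)
embed (lam P)   = lam (embed P)

-- A type frame: M_{σ→τ} is a set of functions M_σ → M_τ, represented by an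
-- application map which is extensional (injective into the function space).
record TypeFrame (K : Set) : Set₁ where
  field
    D    : Ty K → Set
    _·_  : ∀ {σ τ} → D (σ ⇒ τ) → D σ → D τ
    ext  : ∀ {σ τ} (f g : D (σ ⇒ τ)) → (∀ x → f · x ≡ g · x) → f ≡ g

module _ {K : Set} (F : TypeFrame K) where
  open TypeFrame F

  Env : Ctx K → Set
  Env Γ = ∀ {σ} → Γ ∋ σ → D σ

  extend : ∀ {Γ σ} → Env Γ → D σ → Env (σ ∷ Γ)
  extend ρ a here      = a
  extend ρ a (there v) = ρ v

  emptyEnv : Env []
  emptyEnv ()

record IsModel {K : Set} (Λ : Applied K) (F : TypeFrame K) : Set where
  open Applied Λ
  open TypeFrame F
  field
    constI : ∀ {σ} → Const σ → D σ
    ⟦_⟧    : ∀ {Γ σ} → Term Const Γ σ → Env F Γ → D σ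
    ⟦var⟧  : ∀ {Γ σ} (v : Γ ∋ σ) (ρ : Env F Γ) → ⟦ var v ⟧ ρ ≡ ρ v
    ⟦con⟧  : ∀ {Γ σ} (c : Const σ) (ρ : Env F Γ) → ⟦ con c ⟧ ρ ≡ constI c
    ⟦app⟧  : ∀ {Γ σ τ} (P : Term Const Γ (σ ⇒ τ)) (Q : Term Const Γ σ)
             (ρ : Env F Γ) → ⟦ app P Q ⟧ ρ ≡ ⟦ P ⟧ ρ · ⟦ Q ⟧ ρ
    ⟦lam⟧  : ∀ {Γ σ τ} (P : Term Const (σ ∷ Γ) τ) (ρ : Env F Γ) (d : D σ) →
             ⟦ lam P ⟧ ρ · d ≡ ⟦ P ⟧ (extend F ρ d)
    δ-valid : ∀ {Γ σ} (P Q : Term Const Γ σ) → Delta P Q →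
              ∀ (ρ : Env F Γ) → ⟦ P ⟧ ρ ≡ ⟦ Q ⟧ ρ

module _ {K : Set} {Λ : Applied K} {M N : TypeFrame K}
         (mM : IsModel Λ M) (mN : IsModel Λ N) where
  open Applied Λ
  private
    module M = TypeFrame M
    module N = TypeFrame N
    module mM = IsModel mM
    module mN = IsModel mN

  TyRel : Set₁
  TyRel = (σ : Ty K) → M.D σ → N.D σ → Set

  EnvRelated : TyRel → ∀ {Γ} → Env M Γ → Env N Γ → Set
  EnvRelated R {Γ} ρ ρ' = ∀ {σ} (v : Γ ∋ σ) → R σ (ρ v) (ρ' v)

  record IsPreLogical (R : TyRel) : Set where
    field
      app-closed : ∀ {σ τ} (f : M.D (σ ⇒ τ)) (g : N.D (σ ⇒ τ)) (x : M.D σ) (y : N.D σ) →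
                   R (σ ⇒ τ) f g → R σ x y → R τ (f M.· x) (g N.· y)
      lam-closed : ∀ {Γ σ τ} (P : PureTerm (σ ∷ Γ) τ) (ρ : Env M Γ) (ρ' : Env N Γ) →
                   EnvRelated R ρ ρ' →
                   (∀ a b → R σ a b →
                      R τ (mM.⟦ embed P ⟧ (extend M ρ a)) (mN.⟦ embed P ⟧ (extend N ρ' b))) →
                   R (σ ⇒ τ) (mM.⟦ embed (lam P) ⟧ ρ) (mN.⟦ embed (lam P) ⟧ ρ')

  record IsPreLogicalSurjection (R : TyRel) : Set where
    field
      preLogical : IsPreLogical R
      surjective : ∀ σ (y : N.D σ) → ∃ λ (x : M.D σ) → R σ x y
      functional : ∀ σ (x : M.D σ) (y y' : N.D σ) → R σ x y → R σ x y' → y ≡ y'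

  ConstantsRelated : TyRel → Set
  ConstantsRelated R = ∀ {σ} (c : Const σ) → R σ (mM.constI c) (mN.constI c)

Th : {K : Set} {Λ : Applied K} {F : TypeFrame K} → IsModel Λ F →
     ∀ {σ} → Term (Applied.Const Λ) [] σ → Term (Applied.Const Λ) [] σ → Set
Th {F = F} m P Q = IsModel.⟦_⟧ m P (emptyEnv F) ≡ IsModel.⟦_⟧ m Q (emptyEnv F)

-- A closed applied term P denotes, in any model, the value of the pure term obtained by
-- abstracting the constants of P as fresh variables, in the environment sending each such
-- variable to the interpretation of its constant. By the Basic Lemma a pre-logical relation
-- relates the two interpretations of a pure term in related environments, and the
-- interpretations of the constants are related by hypothesis; so E relates ⟦P⟧ᴹ to ⟦P⟧ᴺ.
-- Since E is a partial function, ⟦P⟧ᴹ = ⟦Q⟧ᴹ forces ⟦P⟧ᴺ = ⟦Q⟧ᴺ.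
module Submission where

open import Defs
open import Data.List using ([]; _∷_; _++_)
open import Relation.Binary.PropositionalEquality
  using (_≡_; refl; sym; trans; cong; cong₂; subst; subst₂; module ≡-Reasoning)

module _ {K : Set} where

  VarMap : Ctx K → (Ty K → Set) → Set
  VarMap Γ A = ∀ {σ} → Γ ∋ σ → A σ

  _≗ᵛ_ : ∀ {Γ A} → VarMap Γ A → VarMap Γ A → Set
  ρ ≗ᵛ ρ' = ∀ {σ} v → ρ {σ} v ≡ ρ' v

  _↑ˡ_ : ∀ {Γ σ} → Γ ∋ σ → (Δ : Ctx K) → (Γ ++ Δ) ∋ σ
  here    ↑ˡ Δ = here
  there v ↑ˡ Δ = there (v ↑ˡ Δ)

  _↑ʳ_ : (Γ : Ctx K) → ∀ {Δ σ} → Δ ∋ σ → (Γ ++ Δ) ∋ σ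
  []      ↑ʳ v = v
  (_ ∷ Γ) ↑ʳ v = there (Γ ↑ʳ v)

  _++ᵛ_ : ∀ {A Γ Δ} → VarMap Γ A → VarMap Δ A → VarMap (Γ ++ Δ) A
  _++ᵛ_ {Γ = []}    ρ γ v         = γ v
  _++ᵛ_ {Γ = _ ∷ Γ} ρ γ here      = ρ here
  _++ᵛ_ {Γ = _ ∷ Γ} ρ γ (there v) = ((λ u → ρ (there u)) ++ᵛ γ) v

  ++ᵛ-↑ˡ : ∀ {A Γ Δ} (ρ : VarMap Γ A) (γ : VarMap Δ A) {σ} (v : Γ ∋ σ) →
           (ρ ++ᵛ γ) (v ↑ˡ Δ) ≡ ρ v
  ++ᵛ-↑ˡ ρ γ here      = refl
  ++ᵛ-↑ˡ ρ γ (there v) = ++ᵛ-↑ˡ (λ u → ρ (there u)) γ v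

  ++ᵛ-↑ʳ : ∀ {A} Γ {Δ} (ρ : VarMap Γ A) (γ : VarMap Δ A) {σ} (v : Δ ∋ σ) →
           (ρ ++ᵛ γ) (Γ ↑ʳ v) ≡ γ v
  ++ᵛ-↑ʳ []      ρ γ v = refl
  ++ᵛ-↑ʳ (_ ∷ Γ) ρ γ v = ++ᵛ-↑ʳ Γ (λ u → ρ (there u)) γ v

  ++ᵛ-cong : ∀ {A} Γ {Δ} {ρ ρ' : VarMap Γ A} {γ γ' : VarMap Δ A} →
             ρ ≗ᵛ ρ' → γ ≗ᵛ γ' → (ρ ++ᵛ γ) ≗ᵛ (ρ' ++ᵛ γ')
  ++ᵛ-cong []      eρ eγ v         = eγ v
  ++ᵛ-cong (_ ∷ Γ) eρ eγ here      = eρ here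
  ++ᵛ-cong (_ ∷ Γ) eρ eγ (there v) = ++ᵛ-cong Γ (λ u → eρ (there u)) eγ v

  ∘-++ᵛ : ∀ {A B : Ty K → Set} {Γ Δ} (f : ∀ {σ} → A σ → B σ) (ρ : VarMap Γ A) (γ : VarMap Δ A) →
          ∀ {σ} (v : (Γ ++ Δ) ∋ σ) → f ((ρ ++ᵛ γ) v) ≡ ((λ u → f (ρ u)) ++ᵛ (λ u → f (γ u))) v
  ∘-++ᵛ {Γ = []}    f ρ γ v         = refl
  ∘-++ᵛ {Γ = _ ∷ Γ} f ρ γ here      = refl
  ∘-++ᵛ {Γ = _ ∷ Γ} f ρ γ (there v) = ∘-++ᵛ f (λ u → ρ (there u)) γ v

  Ren : Ctx K → Ctx K → Set
  Ren Γ Δ = VarMap Γ (Δ ∋_)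

  lift : ∀ {Γ Δ τ} → Ren Γ Δ → Ren (τ ∷ Γ) (τ ∷ Δ)
  lift r here      = here
  lift r (there v) = there (r v)

  ren : ∀ {C Γ Δ τ} → Ren Γ Δ → Term C Γ τ → Term C Δ τ
  ren r (var v)   = var (r v)
  ren r (con c)   = con c
  ren r (app P Q) = app (ren r P) (ren r Q)
  ren r (lam P)   = lam (ren (lift r) P)

  embed-ren : ∀ {C Γ Δ τ} (r : Ren Γ Δ) (P : PureTerm Γ τ) →
              embed {C = C} (ren r P) ≡ ren r (embed P)
  embed-ren r (var v)   = refl
  embed-ren r (app P Q) = cong₂ app (embed-ren r P) (embed-ren r Q)
  embed-ren r (lam P)   = cong lam (embed-ren (lift r) P)

  ↑ˡ-middle : (Γ : Ctx K) {Δ₁ : Ctx K} (Δ₂ : Ctx K) → Ren (Γ ++ Δ₁) (Γ ++ (Δ₁ ++ Δ₂))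
  ↑ˡ-middle Γ Δ₂ = (λ v → v ↑ˡ _) ++ᵛ (λ v → Γ ↑ʳ (v ↑ˡ Δ₂))

  ↑ʳ-middle : (Γ Δ₁ : Ctx K) {Δ₂ : Ctx K} → Ren (Γ ++ Δ₂) (Γ ++ (Δ₁ ++ Δ₂))
  ↑ʳ-middle Γ Δ₁ = (λ v → v ↑ˡ _) ++ᵛ (λ v → Γ ↑ʳ (Δ₁ ↑ʳ v))

  ++ᵛ-↑ˡ-middle : ∀ {A Γ Δ₁ Δ₂} (ρ : VarMap Γ A) (γ₁ : VarMap Δ₁ A) (γ₂ : VarMap Δ₂ A) →
                  ∀ {σ} (v : (Γ ++ Δ₁) ∋ σ) → (ρ ++ᵛ (γ₁ ++ᵛ γ₂)) (↑ˡ-middle Γ Δ₂ v) ≡ (ρ ++ᵛ γ₁) v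
  ++ᵛ-↑ˡ-middle {A} {Γ} {Δ₂ = Δ₂} ρ γ₁ γ₂ v =
    trans (∘-++ᵛ (ρ ++ᵛ (γ₁ ++ᵛ γ₂)) (λ u → u ↑ˡ _) (λ u → Γ ↑ʳ (u ↑ˡ Δ₂)) v)
          (++ᵛ-cong Γ (++ᵛ-↑ˡ ρ (γ₁ ++ᵛ γ₂))
                      (λ u → trans (++ᵛ-↑ʳ Γ ρ (γ₁ ++ᵛ γ₂) _) (++ᵛ-↑ˡ γ₁ γ₂ u)) v)

  ++ᵛ-↑ʳ-middle : ∀ {A Γ Δ₁ Δ₂} (ρ : VarMap Γ A) (γ₁ : VarMap Δ₁ A) (γ₂ : VarMap Δ₂ A) →
                  ∀ {σ} (v : (Γ ++ Δ₂) ∋ σ) → (ρ ++ᵛ (γ₁ ++ᵛ γ₂)) (↑ʳ-middle Γ Δ₁ v) ≡ (ρ ++ᵛ γ₂) v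
  ++ᵛ-↑ʳ-middle {A} {Γ} {Δ₁} ρ γ₁ γ₂ v =
    trans (∘-++ᵛ (ρ ++ᵛ (γ₁ ++ᵛ γ₂)) (λ u → u ↑ˡ _) (λ u → Γ ↑ʳ (Δ₁ ↑ʳ u)) v)
          (++ᵛ-cong Γ (++ᵛ-↑ˡ ρ (γ₁ ++ᵛ γ₂))
                      (λ u → trans (++ᵛ-↑ʳ Γ ρ (γ₁ ++ᵛ γ₂) _) (++ᵛ-↑ʳ Δ₁ γ₁ γ₂ u)) v)

  -- The constants of P, in order of occurrence, become the variables of constCtx P.
  constCtx : ∀ {C Γ τ} → Term C Γ τ → Ctx K
  constCtx (var v)     = []
  constCtx (con {σ} c) = σ ∷ []
  constCtx (app P Q)   = constCtx P ++ constCtx Q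
  constCtx (lam P)     = constCtx P

  constVals : ∀ {C Γ τ} (P : Term C Γ τ) → VarMap (constCtx P) C
  constVals (con c)   here = c
  constVals (app P Q)      = constVals P ++ᵛ constVals Q
  constVals (lam P)        = constVals P

  abstractConsts : ∀ {C Γ τ} (P : Term C Γ τ) → PureTerm (Γ ++ constCtx P) τ
  abstractConsts (var v)           = var (v ↑ˡ [])
  abstractConsts {Γ = Γ} (con c)   = var (Γ ↑ʳ here)
  abstractConsts {Γ = Γ} (app P Q) =
    app (ren (↑ˡ-middle Γ (constCtx Q)) (abstractConsts P))
        (ren (↑ʳ-middle Γ (constCtx P)) (abstractConsts Q))
  abstractConsts (lam P)           = lam (abstractConsts P)

module ModelProperties {K : Set} {Λ : Applied K} {F : TypeFrame K} (m : IsModel Λ F) where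
  open Applied Λ
  open TypeFrame F
  open IsModel m

  extend-cong : ∀ {Γ σ} {ρ ρ' : Env F Γ} (d : D σ) → ρ ≗ᵛ ρ' → extend F ρ d ≗ᵛ extend F ρ' d
  extend-cong d e here      = refl
  extend-cong d e (there v) = e v

  ⟦⟧-cong : ∀ {Γ τ} (P : Term Const Γ τ) {ρ ρ' : Env F Γ} → ρ ≗ᵛ ρ' → ⟦ P ⟧ ρ ≡ ⟦ P ⟧ ρ'
  ⟦⟧-cong (var v) {ρ} {ρ'} e = trans (⟦var⟧ v ρ) (trans (e v) (sym (⟦var⟧ v ρ')))
  ⟦⟧-cong (con c) {ρ} {ρ'} e = trans (⟦con⟧ c ρ) (sym (⟦con⟧ c ρ'))
  ⟦⟧-cong (app P Q) {ρ} {ρ'} e =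
    trans (⟦app⟧ P Q ρ) (trans (cong₂ _·_ (⟦⟧-cong P e) (⟦⟧-cong Q e)) (sym (⟦app⟧ P Q ρ')))
  ⟦⟧-cong (lam P) {ρ} {ρ'} e = ext _ _ λ d →
    trans (⟦lam⟧ P ρ d) (trans (⟦⟧-cong P (extend-cong d e)) (sym (⟦lam⟧ P ρ' d)))

  ⟦ren⟧ : ∀ {Γ Δ τ} (r : Ren Γ Δ) (P : Term Const Γ τ) (ρ : Env F Δ) →
          ⟦ ren r P ⟧ ρ ≡ ⟦ P ⟧ (λ v → ρ (r v))
  ⟦ren⟧ r (var v)   ρ = trans (⟦var⟧ (r v) ρ) (sym (⟦var⟧ v _))
  ⟦ren⟧ r (con c)   ρ = trans (⟦con⟧ c ρ) (sym (⟦con⟧ c _))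
  ⟦ren⟧ r (app P Q) ρ =
    trans (⟦app⟧ _ _ ρ) (trans (cong₂ _·_ (⟦ren⟧ r P ρ) (⟦ren⟧ r Q ρ)) (sym (⟦app⟧ P Q _)))
  ⟦ren⟧ r (lam P)   ρ = ext _ _ λ d →
    trans (⟦lam⟧ _ ρ d)
      (trans (⟦ren⟧ (lift r) P (extend F ρ d))
        (trans (⟦⟧-cong P λ { here → refl ; (there v) → refl }) (sym (⟦lam⟧ P _ d))))

  ⟦embed-ren⟧ : ∀ {Γ Δ τ} (r : Ren Γ Δ) (P : PureTerm Γ τ) (ρ : Env F Δ) →
                ⟦ embed (ren r P) ⟧ ρ ≡ ⟦ embed P ⟧ (λ v → ρ (r v))
  ⟦embed-ren⟧ r P ρ = trans (cong (λ R → ⟦ R ⟧ ρ) (embed-ren r P)) (⟦ren⟧ r (embed P) ρ)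

  constEnv : ∀ {Γ τ} (P : Term Const Γ τ) → Env F (constCtx P)
  constEnv P v = constI (constVals P v)

  ⟦abstractConsts⟧ : ∀ {Γ τ} (P : Term Const Γ τ) (ρ : Env F Γ) →
                     ⟦ embed (abstractConsts P) ⟧ (ρ ++ᵛ constEnv P) ≡ ⟦ P ⟧ ρ
  ⟦abstractConsts⟧ (var v) ρ =
    trans (⟦var⟧ _ _) (trans (++ᵛ-↑ˡ ρ _ v) (sym (⟦var⟧ v ρ)))
  ⟦abstractConsts⟧ {Γ} (con c) ρ =
    trans (⟦var⟧ _ _) (trans (++ᵛ-↑ʳ Γ ρ _ here) (sym (⟦con⟧ c ρ)))
  ⟦abstractConsts⟧ {Γ} (app P Q) ρ = begin
      ⟦ embed (abstractConsts (app P Q)) ⟧ ρκ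
    ≡⟨ ⟦app⟧ _ _ ρκ ⟩
      ⟦ embed (ren _ (abstractConsts P)) ⟧ ρκ · ⟦ embed (ren _ (abstractConsts Q)) ⟧ ρκ
    ≡⟨ cong₂ _·_ (⟦embed-ren⟧ _ (abstractConsts P) ρκ) (⟦embed-ren⟧ _ (abstractConsts Q) ρκ) ⟩
      ⟦ embed (abstractConsts P) ⟧ _ · ⟦ embed (abstractConsts Q) ⟧ _
    ≡⟨ cong₂ _·_ (⟦⟧-cong (embed (abstractConsts P)) (λ v → trans (split (↑ˡ-middle Γ _ v))
                                                            (++ᵛ-↑ˡ-middle ρ _ _ v)))
                 (⟦⟧-cong (embed (abstractConsts Q)) (λ v → trans (split (↑ʳ-middle Γ _ v))
                                                            (++ᵛ-↑ʳ-middle ρ _ _ v))) ⟩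
      ⟦ embed (abstractConsts P) ⟧ (ρ ++ᵛ constEnv P) · ⟦ embed (abstractConsts Q) ⟧ (ρ ++ᵛ constEnv Q)
    ≡⟨ cong₂ _·_ (⟦abstractConsts⟧ P ρ) (⟦abstractConsts⟧ Q ρ) ⟩
      ⟦ P ⟧ ρ · ⟦ Q ⟧ ρ
    ≡⟨ sym (⟦app⟧ P Q ρ) ⟩
      ⟦ app P Q ⟧ ρ
    ∎
    where
      open ≡-Reasoning
      ρκ : Env F (Γ ++ constCtx (app P Q))
      ρκ = ρ ++ᵛ constEnv (app P Q)
      split : ρκ ≗ᵛ (ρ ++ᵛ (constEnv P ++ᵛ constEnv Q))
      split = ++ᵛ-cong {A = D} Γ (λ _ → refl) (∘-++ᵛ constI (constVals P) (constVals Q))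
  ⟦abstractConsts⟧ (lam P) ρ = ext _ _ λ d →
    trans (⟦lam⟧ _ _ d)
      (trans (⟦⟧-cong (embed (abstractConsts P)) λ { here → refl ; (there v) → refl })
        (trans (⟦abstractConsts⟧ P (extend F ρ d)) (sym (⟦lam⟧ P ρ d))))

module _ {K : Set} {Λ : Applied K} {M N : TypeFrame K}
         {mM : IsModel Λ M} {mN : IsModel Λ N} {E : TyRel mM mN} where
  open Applied Λ using (Const)
  private
    module mM = IsModel mM
    module mN = IsModel mN

  extend-related : ∀ {Γ σ} {ρ : Env M Γ} {ρ' : Env N Γ} {a b} →
                   EnvRelated mM mN E ρ ρ' → E σ a b →
                   EnvRelated mM mN E (extend M ρ a) (extend N ρ' b)
  extend-related ρρ' ab here      = ab
  extend-related ρρ' ab (there v) = ρρ' v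

  basic-lemma : IsPreLogical mM mN E →
                ∀ {Γ τ} (P : PureTerm Γ τ) {ρ : Env M Γ} {ρ' : Env N Γ} →
                EnvRelated mM mN E ρ ρ' → E τ (mM.⟦ embed P ⟧ ρ) (mN.⟦ embed P ⟧ ρ')
  basic-lemma pl (var v) {ρ} {ρ'} ρρ' =
    subst₂ (E _) (sym (mM.⟦var⟧ v ρ)) (sym (mN.⟦var⟧ v ρ')) (ρρ' v)
  basic-lemma pl (app P Q) {ρ} {ρ'} ρρ' =
    subst₂ (E _) (sym (mM.⟦app⟧ _ _ ρ)) (sym (mN.⟦app⟧ _ _ ρ'))
      (IsPreLogical.app-closed pl _ _ _ _ (basic-lemma pl P ρρ') (basic-lemma pl Q ρρ'))
  basic-lemma pl (lam P) {ρ} {ρ'} ρρ' =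
    IsPreLogical.lam-closed pl P ρ ρ' ρρ' λ a b ab → basic-lemma pl P (extend-related ρρ' ab)

  -- For Γ = [] the environment emptyEnv ++ᵛ constEnv P reduces to constEnv P.
  closed-related : IsPreLogical mM mN E → ConstantsRelated mM mN E →
                   ∀ {τ} (P : Term Const [] τ) →
                   E τ (mM.⟦ P ⟧ (emptyEnv M)) (mN.⟦ P ⟧ (emptyEnv N))
  closed-related pl consts P =
    subst₂ (E _) (ModelProperties.⟦abstractConsts⟧ mM P (emptyEnv M))
                 (ModelProperties.⟦abstractConsts⟧ mN P (emptyEnv N))
      (basic-lemma pl (abstractConsts P) λ v → consts (constVals P v))

corollary5p3 : {K : Set} (Λ : Applied K) (M N : TypeFrame K)
    (mM : IsModel Λ M) (mN : IsModel Λ N) (E : TyRel mM mN) →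
    IsPreLogicalSurjection mM mN E →
    ConstantsRelated mM mN E →
    ∀ {σ} (P Q : Term (Applied.Const Λ) [] σ) →
    Th mM P Q → Th mN P Q
corollary5p3 Λ M N mM mN E surj consts P Q PᴹQᴹ =
  functional _ _ _ _ (subst (λ x → E _ x _) PᴹQᴹ (closed-related preLogical consts P))
                     (closed-related preLogical consts Q)
  where open IsPreLogicalSurjection surj
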